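{- Let $n\geq2$ and $0\leq k\leq n$. The set of smooth signed permutations $\pi\in\mathfrak{B}_n^{+}$ with $\mathrm{des}_B(\pi)=k$ is in bijection with the set of $\pi\in\mathfrak{D}_n^{+}$ with $\mathrm{des}_D(\pi)=k$.
   Context: $\mathfrak{B}_n$ is the set of signed permutations $\pi=\pi_1\cdots\pi_n$ of $[n]$; with $\pi_0=0$, $\mathrm{des}_B(\pi)=|\{i\in\{0,\dots,n-1\}:\pi_i>\pi_{i+1}\}|$. $\mathfrak{D}_n$ is the subset of $\mathfrak{B}_n$ with an even number of negative entries; for $\pi\in\mathfrak{D}_n$, $\mathrm{Des}_D(\pi)=\{0:\pi_1+\pi_2<0\}\cup\{i\in\{1,\dots,n-1\}:\pi_i>\pi_{i+1}\}$ and $\mathrm{des}_D(\pi)=|\mathrm{Des}_D(\pi)|$. $\mathfrak{B}_n^{+}=\{\pi\in\mathfrak{B}_n:\pi_n>0\}$ and $\mathfrak{D}_n^{+}=\mathfrak{D}_n\cap\mathfrak{B}_n^{+}$. A signed permutation $\pi$ is smooth if $\pi_1\cdot\pi_2>0$, and non-smooth otherwise. -}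

module Defs where

open import Data.Nat using (ℕ; zero; suc; _+_)
open import Data.Nat.Divisibility using (_∣_)
open import Data.Integer using (ℤ; +_; _<_; _≤_; ∣_∣; _<?_)
  renaming (_*_ to _*ℤ_; _+_ to _+ℤ_)
import Data.Nat as ℕ
open import Data.Fin using (Fin)
open import Data.Vec using (Vec; lookup; toList)
open import Data.List using (List; []; _∷_; last; length; filter)
open import Data.Maybe using (Maybe; just; nothing)
open import Data.Product using (Σ; _×_; proj₁)
open import Data.Unit using (⊤)
open import Data.Empty using (⊥)
open import Relation.Nullary.Decidable using (⌊_⌋)
open import Relation.Binary.PropositionalEquality using (_≡_)
open import Relation.Binary.Bundles using (Setoid)
import Relation.Binary.PropositionalEquality as P
import Relation.Binary.Construct.On as On
open import Data.Bool using (if_then_else_)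

-- A signed permutation of [n], written in one-line notation π₁ ⋯ πₙ,
-- as a vector of integers: every |πᵢ| lies in [n] and i ↦ |πᵢ| is injective
-- (hence a permutation of [n]).
IsSignedPerm : (n : ℕ) → Vec ℤ n → Set
IsSignedPerm n v =
  (∀ i → 1 ℕ.≤ ∣ lookup v i ∣ × ∣ lookup v i ∣ ℕ.≤ n) ×
  (∀ i j → ∣ lookup v i ∣ ≡ ∣ lookup v j ∣ → i ≡ j)

SignedPerm : ℕ → Set
SignedPerm n = Σ (Vec ℤ n) (IsSignedPerm n)

descents : List ℤ → ℕ
descents [] = 0
descents (x ∷ []) = 0
descents (x ∷ y ∷ xs) = (if ⌊ y <? x ⌋ then 1 else 0) + descents (y ∷ xs)

desB : ∀ {n} → Vec ℤ n → ℕ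
desB v = descents (+ 0 ∷ toList v)

zeroDesD : List ℤ → ℕ
zeroDesD (x ∷ y ∷ _) = if ⌊ x +ℤ y <? + 0 ⌋ then 1 else 0
zeroDesD _ = 0

desD : ∀ {n} → Vec ℤ n → ℕ
desD v = zeroDesD (toList v) + descents (toList v)

negCount : ∀ {n} → Vec ℤ n → ℕ
negCount v = length (filter (λ x → x <? + 0) (toList v))

LastPositive : List ℤ → Set
LastPositive xs with last xs
... | just x = + 0 < x
... | nothing = ⊥

Smooth : List ℤ → Set
Smooth (x ∷ y ∷ _) = + 0 < x *ℤ y
Smooth _ = ⊥

SmoothBplus : ℕ → ℕ → Set
SmoothBplus n k = Σ (SignedPerm n) λ π →
  LastPositive (toList (proj₁ π)) × Smooth (toList (proj₁ π)) × desB (proj₁ π) ≡ k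

Dplus : ℕ → ℕ → Set
Dplus n k = Σ (SignedPerm n) λ π →
  2 ∣ negCount (proj₁ π) × LastPositive (toList (proj₁ π)) × desD (proj₁ π) ≡ k

SmoothBplusSetoid : ℕ → ℕ → Setoid _ _
SmoothBplusSetoid n k = On.setoid (P.setoid (Vec ℤ n)) (λ (x : SmoothBplus n k) → proj₁ (proj₁ x))

DplusSetoid : ℕ → ℕ → Setoid _ _
DplusSetoid n k = On.setoid (P.setoid (Vec ℤ n)) (λ (x : Dplus n k) → proj₁ (proj₁ x))

-- Negating the first entry π₁ is an involution of signed permutations of length n ≥ 2
-- which keeps πₙ, flips the parity of the number of negative entries, and (all entries
-- being nonzero) flips smoothness. For smooth π the entries π₁, π₂ have the same sign,
-- so π₁ < 0 iff π₁ + π₂ < 0, whence des_B(π) = des_D(π); and for π′ = π with π₁ negated,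
-- 0 ∈ Des_D(π′) iff π₂ < π₁ while π₂ < π′₁ iff π₁ < 0, so des_D(π′) = des_B(π).
-- Hence π ↦ (π if π ∈ 𝔇ₙ, else π′) maps the smooth part of 𝔅ₙ⁺ onto 𝔇ₙ⁺ preserving the
-- descent number, with inverse σ ↦ (σ if σ is smooth, else σ′).
module Submission where

open import Defs
open import Data.Nat using (ℕ; _≤_; suc; s≤s; z≤n; z<s)
import Data.Nat as ℕ
import Data.Nat.Properties as ℕ
open import Data.Nat.Divisibility using (_∣_; _∤_; _∣?_; ∣-refl; _∣0; ∣1⇒≡1; ∣m∣n⇒∣m+n; ∣m+n∣m⇒∣n)
open import Algebra.Properties.CommutativeSemigroup ℕ.+-commutativeSemigroup using (x∙yz≈y∙xz)
open import Data.Integer using (ℤ; +0; +[1+_]; -[1+_]; 0ℤ; -_; _+_; _*_; _<_; _≮_; _<?_; -<+; +<+)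
import Data.Integer as ℤ
open import Data.Integer.Properties
  using (∣-i∣≡∣i∣; neg-involutive; +-assoc; +-identityˡ; +-identityʳ; +-inverseˡ; +-inverseʳ; +-monoʳ-<; *-zeroʳ; <-irrefl)
open import Data.Fin using (zero; suc)
open import Data.Vec using (Vec; _∷_; lookup; toList)
open import Data.List using (List; _∷_; last)
open import Data.Maybe using (just; nothing)
open import Data.Product using (_×_; _,_; proj₁)
open import Data.Sum using (_⊎_; inj₁; [_,_]′; swap; map₁)
open import Data.Bool using (if_then_else_)
open import Function using (id; const)
open import Function.Bundles using (Bijection; Inverse; _⇔_; mk⇔; Equivalence)
open import Function.Properties.Inverse using (Inverse⇒Bijection)
open import Relation.Nullary using (Dec; yes; no; ¬_; contradiction)
open import Relation.Nullary.Decidable using (⌊_⌋; isYes≗does; does-⇔)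
open import Relation.Binary.PropositionalEquality
  using (_≡_; refl; sym; trans; cong; cong₂; subst; subst₂; module ≡-Reasoning)

open Equivalence using (to; from)

2∣⊎2∣suc : ∀ n → 2 ∣ n ⊎ 2 ∣ suc n
2∣⊎2∣suc ℕ.zero  = inj₁ (2 ∣0)
2∣⊎2∣suc (suc n) = swap (map₁ (∣m∣n⇒∣m+n ∣-refl) (2∣⊎2∣suc n))

2∣⇒2∤suc : ∀ {n} → 2 ∣ n → 2 ∤ suc n
2∣⇒2∤suc {n} 2∣n 2∣1+n with () ← ∣1⇒≡1 (∣m+n∣m⇒∣n (subst (2 ∣_) (ℕ.+-comm 1 n) 2∣1+n) 2∣n)

2∣suc⇔2∤ : ∀ {n} → 2 ∣ suc n ⇔ 2 ∤ n
2∣suc⇔2∤ {n} = mk⇔ (λ 2∣1+n 2∣n → 2∣⇒2∤suc 2∣n 2∣1+n)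
                   (λ 2∤n → [ (λ 2∣n → contradiction 2∣n 2∤n) , id ]′ (2∣⊎2∣suc n))

2∣⇔2∤suc : ∀ {n} → 2 ∣ n ⇔ 2 ∤ suc n
2∣⇔2∤suc {n} = mk⇔ 2∣⇒2∤suc
                   (λ 2∤1+n → [ id , (λ 2∣1+n → contradiction 2∣1+n 2∤1+n) ]′ (2∣⊎2∣suc n))

isYes-⇔ : ∀ {A B : Set} → A ⇔ B → (a? : Dec A) (b? : Dec B) → ⌊ a? ⌋ ≡ ⌊ b? ⌋
isYes-⇔ A⇔B a? b? = trans (isYes≗does a?) (trans (does-⇔ A⇔B a? b?) (sym (isYes≗does b?)))

-i+j<0⇔j<i : ∀ i j → - i + j < 0ℤ ⇔ j < i
-i+j<0⇔j<i i j = mk⇔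
  (λ -i+j<0 → subst₂ _<_ i+[-i+j]≡j (+-identityʳ i) (+-monoʳ-< i -i+j<0))
  (λ j<i → subst (- i + j <_) (+-inverseˡ i) (+-monoʳ-< (- i) j<i))
  where
  open ≡-Reasoning
  i+[-i+j]≡j : i + (- i + j) ≡ j
  i+[-i+j]≡j = begin
    i + (- i + j)  ≡⟨ sym (+-assoc i (- i) j) ⟩
    i + - i + j    ≡⟨ cong (_+ j) (+-inverseʳ i) ⟩
    0ℤ + j         ≡⟨ +-identityˡ j ⟩
    j              ∎

data SameSign : ℤ → ℤ → Set where
  positive : ∀ {a b} → SameSign +[1+ a ] +[1+ b ]
  negative : ∀ {a b} → SameSign -[1+ a ] -[1+ b ]

0<*⇒sameSign : ∀ x y → 0ℤ < x * y → SameSign x y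
0<*⇒sameSign +0         _          (+<+ ())
0<*⇒sameSign x          +0         0<x*0 = contradiction (subst (0ℤ <_) (*-zeroʳ x) 0<x*0) (<-irrefl refl)
0<*⇒sameSign +[1+ _ ]   +[1+ _ ]   _ = positive
0<*⇒sameSign +[1+ _ ]   -[1+ _ ]   ()
0<*⇒sameSign -[1+ _ ]   +[1+ _ ]   ()
0<*⇒sameSign -[1+ _ ]   -[1+ _ ]   _ = negative

sameSign⇒y<-x⇔x<0 : ∀ {x y} → SameSign x y → y < - x ⇔ x < 0ℤ
sameSign⇒y<-x⇔x<0 positive = mk⇔ (λ ()) (λ { (+<+ ()) })
sameSign⇒y<-x⇔x<0 negative = mk⇔ (const -<+) (const -<+)

0<-x*y⇔0≮x*y : ∀ x y → 0 ℕ.< ℤ.∣ x ∣ → 0 ℕ.< ℤ.∣ y ∣ → 0ℤ < - x * y ⇔ 0ℤ ≮ x * y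
0<-x*y⇔0≮x*y +0       _        ()
0<-x*y⇔0≮x*y _        +0       _ ()
0<-x*y⇔0≮x*y +[1+ _ ] +[1+ _ ] _ _ = mk⇔ (λ ()) (λ 0≮x*y → contradiction (+<+ z<s) 0≮x*y)
0<-x*y⇔0≮x*y +[1+ _ ] -[1+ _ ] _ _ = mk⇔ (λ _ ()) (const (+<+ z<s))
0<-x*y⇔0≮x*y -[1+ _ ] +[1+ _ ] _ _ = mk⇔ (λ _ ()) (const (+<+ z<s))
0<-x*y⇔0≮x*y -[1+ _ ] -[1+ _ ] _ _ = mk⇔ (λ ()) (λ 0≮x*y → contradiction (+<+ z<s) 0≮x*y)

IsSignedPerm-resp-∣∣ : ∀ {n} {v w : Vec ℤ n} → (∀ i → ℤ.∣ lookup v i ∣ ≡ ℤ.∣ lookup w i ∣) →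
                       IsSignedPerm n v → IsSignedPerm n w
IsSignedPerm-resp-∣∣ {n} v≈w (bounded , injective) =
  (λ i → subst (λ a → 1 ℕ.≤ a × a ℕ.≤ n) (v≈w i) (bounded i)) ,
  (λ i j eq → injective i j (trans (v≈w i) (trans eq (sym (v≈w j)))))

LastPositive-resp-last : ∀ {xs ys : List ℤ} → last xs ≡ last ys → LastPositive xs → LastPositive ys
LastPositive-resp-last {xs} {ys} eq xs⁺ with last xs | last ys | eq
... | just _  | just _  | refl = xs⁺
... | nothing | nothing | refl = xs⁺

negateHead : ∀ {n} → Vec ℤ (suc n) → Vec ℤ (suc n)
negateHead (x ∷ xs) = - x ∷ xs

negateHead-involutive : ∀ {n} (v : Vec ℤ (suc n)) → negateHead (negateHead v) ≡ v
negateHead-involutive (x ∷ xs) = cong (_∷ xs) (neg-involutive x)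

∣lookup-negateHead∣ : ∀ {n} (v : Vec ℤ (suc n)) i → ℤ.∣ lookup (negateHead v) i ∣ ≡ ℤ.∣ lookup v i ∣
∣lookup-negateHead∣ (x ∷ _) zero    = ∣-i∣≡∣i∣ x
∣lookup-negateHead∣ (_ ∷ _) (suc _) = refl

negateHead-isSignedPerm : ∀ {n} (v : Vec ℤ (suc n)) →
                          IsSignedPerm (suc n) v → IsSignedPerm (suc n) (negateHead v)
negateHead-isSignedPerm v =
  IsSignedPerm-resp-∣∣ {v = v} {w = negateHead v} (λ i → sym (∣lookup-negateHead∣ v i))

negateHead-lastPositive : ∀ {n} (v : Vec ℤ (suc (suc n))) →
                          LastPositive (toList v) → LastPositive (toList (negateHead v))
negateHead-lastPositive (x ∷ y ∷ xs) =
  LastPositive-resp-last {x ∷ y ∷ toList xs} { - x ∷ y ∷ toList xs} refl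

2∣negCount-negateHead⇔2∤negCount : ∀ {n} (v : Vec ℤ (suc n)) → 0 ℕ.< ℤ.∣ lookup v zero ∣ →
                                   2 ∣ negCount (negateHead v) ⇔ 2 ∤ negCount v
2∣negCount-negateHead⇔2∤negCount (+[1+ _ ] ∷ _) _ = 2∣suc⇔2∤
2∣negCount-negateHead⇔2∤negCount (-[1+ _ ] ∷ _) _ = 2∣⇔2∤suc

smooth? : ∀ {n} (v : Vec ℤ (suc (suc n))) → Dec (Smooth (toList v))
smooth? (x ∷ y ∷ _) = 0ℤ <? x * y

smooth-negateHead⇔¬smooth : ∀ {n} (v : Vec ℤ (suc (suc n))) → IsSignedPerm (suc (suc n)) v →
                            Smooth (toList (negateHead v)) ⇔ (¬ Smooth (toList v))
smooth-negateHead⇔¬smooth (x ∷ y ∷ _) (bounded , _) =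
  0<-x*y⇔0≮x*y x y (proj₁ (bounded zero)) (proj₁ (bounded (suc zero)))

smooth⇒desB≡desD : ∀ {n} (v : Vec ℤ (suc (suc n))) → Smooth (toList v) → desB v ≡ desD v
smooth⇒desB≡desD (x ∷ y ∷ _) smooth with 0<*⇒sameSign x y smooth
... | positive = refl
... | negative = refl

smooth⇒desD-negateHead≡desB : ∀ {n} (v : Vec ℤ (suc (suc n))) → Smooth (toList v) →
                              desD (negateHead v) ≡ desB v
smooth⇒desD-negateHead≡desB (x ∷ y ∷ xs) smooth = begin
  [ - x + y <? 0ℤ ] ℕ.+ ([ y <? - x ] ℕ.+ D)  ≡⟨ cong₂ (λ a b → a ℕ.+ (b ℕ.+ D)) first second ⟩
  [ y <? x ] ℕ.+ ([ x <? 0ℤ ] ℕ.+ D)         ≡⟨ x∙yz≈y∙xz [ y <? x ] [ x <? 0ℤ ] D ⟩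
  [ x <? 0ℤ ] ℕ.+ ([ y <? x ] ℕ.+ D)         ∎
  where
  open ≡-Reasoning
  D = descents (y ∷ toList xs)
  [_] : ∀ {P : Set} → Dec P → ℕ
  [ p ] = if ⌊ p ⌋ then 1 else 0
  first : [ - x + y <? 0ℤ ] ≡ [ y <? x ]
  first = cong (λ b → if b then 1 else 0) (isYes-⇔ (-i+j<0⇔j<i x y) _ _)
  second : [ y <? - x ] ≡ [ x <? 0ℤ ]
  second = cong (λ b → if b then 1 else 0)
                (isYes-⇔ (sameSign⇒y<-x⇔x<0 (0<*⇒sameSign x y smooth)) _ _)

negateHeadUnless : ∀ {P : Set} {n} → Dec P → Vec ℤ (suc n) → Vec ℤ (suc n)
negateHeadUnless (yes _) v = v
negateHeadUnless (no _)  v = negateHead v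

negateHeadUnless-elim : ∀ {P : Set} {n} (C : Vec ℤ (suc n) → Set) (P? : Dec P)
                        {v : Vec ℤ (suc n)} → (P → C v) → (¬ P → C (negateHead v)) → C (negateHeadUnless P? v)
negateHeadUnless-elim C (yes p) onYes _    = onYes p
negateHeadUnless-elim C (no ¬p) _    onNo = onNo ¬p

negateHeadUnless-yes : ∀ {P : Set} {n} {v : Vec ℤ (suc n)} → P → (P? : Dec P) →
                       negateHeadUnless P? v ≡ v
negateHeadUnless-yes p (yes _) = refl
negateHeadUnless-yes p (no ¬p) = contradiction p ¬p

negateHeadUnless-no : ∀ {P : Set} {n} {v : Vec ℤ (suc n)} → ¬ P → (P? : Dec P) →
                      negateHeadUnless P? v ≡ negateHead v
negateHeadUnless-no ¬p (yes p) = contradiction p ¬p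
negateHeadUnless-no ¬p (no _)  = refl

module SmoothBplus↔Dplus (m k : ℕ) where

  n : ℕ
  n = suc (suc m)

  InSmoothBplus : Vec ℤ n → Set
  InSmoothBplus v = IsSignedPerm n v × LastPositive (toList v) × Smooth (toList v) × desB v ≡ k

  InDplus : Vec ℤ n → Set
  InDplus w = IsSignedPerm n w × 2 ∣ negCount w × LastPositive (toList w) × desD w ≡ k

  even⇒inDplus : ∀ {v} → InSmoothBplus v → 2 ∣ negCount v → InDplus v
  even⇒inDplus {v} (sp , lp , smooth , desB≡k) even =
    sp , even , lp , trans (sym (smooth⇒desB≡desD v smooth)) desB≡k

  odd⇒inDplus-negateHead : ∀ {v} → InSmoothBplus v → 2 ∤ negCount v → InDplus (negateHead v)
  odd⇒inDplus-negateHead {v} (sp , lp , smooth , desB≡k) odd =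
    negateHead-isSignedPerm v sp ,
    from (2∣negCount-negateHead⇔2∤negCount v (proj₁ (proj₁ sp zero))) odd ,
    negateHead-lastPositive v lp ,
    trans (smooth⇒desD-negateHead≡desB v smooth) desB≡k

  smooth⇒inSmoothBplus : ∀ {w} → InDplus w → Smooth (toList w) → InSmoothBplus w
  smooth⇒inSmoothBplus {w} (sp , _ , lp , desD≡k) smooth =
    sp , lp , smooth , trans (smooth⇒desB≡desD w smooth) desD≡k

  ¬smooth⇒inSmoothBplus-negateHead : ∀ {w} → InDplus w → ¬ Smooth (toList w) →
                                     InSmoothBplus (negateHead w)
  ¬smooth⇒inSmoothBplus-negateHead {w} (sp , _ , lp , desD≡k) ¬smooth =
    negateHead-isSignedPerm w sp , negateHead-lastPositive w lp , smooth′ , desB≡k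
    where
    open ≡-Reasoning
    smooth′ : Smooth (toList (negateHead w))
    smooth′ = from (smooth-negateHead⇔¬smooth w sp) ¬smooth
    desB≡k : desB (negateHead w) ≡ k
    desB≡k = begin
      desB (negateHead w)                ≡⟨ smooth⇒desD-negateHead≡desB (negateHead w) smooth′ ⟨
      desD (negateHead (negateHead w))   ≡⟨ cong desD (negateHead-involutive w) ⟩
      desD w                             ≡⟨ desD≡k ⟩
      k                                  ∎

  toVec : Vec ℤ n → Vec ℤ n
  toVec v = negateHeadUnless (2 ∣? negCount v) v

  fromVec : Vec ℤ n → Vec ℤ n
  fromVec w = negateHeadUnless (smooth? w) w

  toVec-inDplus : ∀ {v} → InSmoothBplus v → InDplus (toVec v)
  toVec-inDplus {v} v∈ =
    negateHeadUnless-elim InDplus (2 ∣? negCount v) (even⇒inDplus v∈) (odd⇒inDplus-negateHead v∈)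

  fromVec-inSmoothBplus : ∀ {w} → InDplus w → InSmoothBplus (fromVec w)
  fromVec-inSmoothBplus {w} w∈ =
    negateHeadUnless-elim InSmoothBplus (smooth? w)
      (smooth⇒inSmoothBplus w∈) (¬smooth⇒inSmoothBplus-negateHead w∈)

  fromVec-toVec : ∀ {v} → InSmoothBplus v → fromVec (toVec v) ≡ v
  fromVec-toVec {v} (sp , _ , smooth , _) =
    negateHeadUnless-elim (λ u → fromVec u ≡ v) (2 ∣? negCount v)
      (λ _ → negateHeadUnless-yes smooth (smooth? v))
      (λ _ → trans (negateHeadUnless-no ¬smooth′ (smooth? (negateHead v))) (negateHead-involutive v))
    where
    ¬smooth′ : ¬ Smooth (toList (negateHead v))
    ¬smooth′ smooth′ = to (smooth-negateHead⇔¬smooth v sp) smooth′ smooth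

  toVec-fromVec : ∀ {w} → InDplus w → toVec (fromVec w) ≡ w
  toVec-fromVec {w} (sp , even , _ , _) =
    negateHeadUnless-elim (λ u → toVec u ≡ w) (smooth? w)
      (λ _ → negateHeadUnless-yes even (2 ∣? negCount w))
      (λ _ → trans (negateHeadUnless-no odd′ (2 ∣? negCount (negateHead w))) (negateHead-involutive w))
    where
    odd′ : 2 ∤ negCount (negateHead w)
    odd′ even′ = to (2∣negCount-negateHead⇔2∤negCount w (proj₁ (proj₁ sp zero))) even′ even

  toDplus : SmoothBplus n k → Dplus n k
  toDplus ((v , sp) , v∈) = let sp′ , w∈ = toVec-inDplus {v} (sp , v∈) in
                            (toVec v , sp′) , w∈

  fromDplus : Dplus n k → SmoothBplus n k
  fromDplus ((w , sp) , w∈) = let sp′ , v∈ = fromVec-inSmoothBplus {w} (sp , w∈) in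
                              (fromVec w , sp′) , v∈

  inverse : Inverse (SmoothBplusSetoid n k) (DplusSetoid n k)
  inverse = record
    { to        = toDplus
    ; from      = fromDplus
    ; to-cong   = cong toVec
    ; from-cong = cong fromVec
    ; inverse   = (λ { {(w , sp) , w∈} v≡fromVec-w →
                         trans (cong toVec v≡fromVec-w) (toVec-fromVec {w} (sp , w∈)) })
                , (λ { {(v , sp) , v∈} w≡toVec-v →
                         trans (cong fromVec w≡toVec-v) (fromVec-toVec {v} (sp , v∈)) })
    }

lemma3p1 : (n k : ℕ) → 2 ≤ n → k ≤ n →
    Bijection (SmoothBplusSetoid n k) (DplusSetoid n k)
lemma3p1 (suc (suc m)) k (s≤s (s≤s z≤n)) _ = Inverse⇒Bijection (SmoothBplus↔Dplus.inverse m k)
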